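{- Let $G=(V,E)$ be a loop-free multigraph. Every vertex order $\sigma$ produced by the greedy algorithm (with any tie-breaking) satisfies $\sum_{v\in V}\overleftarrow{d}_\sigma(v)^2\le \overleftarrow{d}_{\min}(G)\cdot \min_{\tau}\sum_{v\in V}\overleftarrow{d}_\tau(v)^2$, where the minimum is over all vertex orders $\tau$ of $G$; i.e., the greedy algorithm is a $\overleftarrow{d}_{\min}(G)$-approximation for minimizing $\sum_{v\in V}\overleftarrow{d}(v)^2$.
   Context: A vertex order is a linear ordering $\sigma=(\sigma_1,\dots,\sigma_n)$ of $V$; the left-degree $\overleftarrow{d}_\sigma(v)$ of $v=\sigma_i$ is the number of edges (with multiplicity) joining $v$ to $\{\sigma_1,\dots,\sigma_{i-1}\}$. A vertex order is $k$-bounded if every left-degree is at most $k$; the degeneracy $\overleftarrow{d}_{\min}(G)$ is the smallest $k$ for which a $k$-bounded order exists. The greedy algorithm builds the order from right to left: repeatedly, it picks a vertex of minimum degree in the current (remaining) graph, places it at the last still-free position, and deletes it from the graph. -}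

module Defs where

open import Data.Nat using (ℕ; zero; suc; _+_; _*_; _≤_; _<_)
open import Data.Fin using (Fin; zero; suc) renaming (_<_ to _<ᶠ_; _≤_ to _≤ᶠ_)
open import Data.Fin.Permutation using (Permutation′; _⟨$⟩ʳ_)
open import Data.Product using (Σ; _×_; ∃)
open import Relation.Binary.PropositionalEquality using (_≡_)
open import Relation.Nullary using (Dec; yes; no)

sumFin : {n : ℕ} → (Fin n → ℕ) → ℕ
sumFin {zero}  f = 0
sumFin {suc n} f = f zero + sumFin (λ i → f (suc i))

record Multigraph (n : ℕ) : Set where
  field
    mult     : Fin n → Fin n → ℕ
    symm     : ∀ u v → mult u v ≡ mult v u
    loopFree : ∀ v → mult v v ≡ 0
open Multigraph public

-- A vertex order: σ ⟨$⟩ʳ i is the vertex at position i (σ_{i+1} in the paper).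
VertexOrder : ℕ → Set
VertexOrder n = Permutation′ n

sumBefore : {n : ℕ} → Fin n → (Fin n → ℕ) → ℕ
sumBefore i f = sumFin (λ j → indicator j)
  where
    indicator : _ → ℕ
    indicator j with Data.Fin._<?_ j i
    ... | yes _ = f j
    ... | no  _ = 0

sumUpTo : {n : ℕ} → Fin n → (Fin n → ℕ) → ℕ
sumUpTo i f = sumFin (λ j → indicator j)
  where
    indicator : _ → ℕ
    indicator j with Data.Fin._≤?_ j i
    ... | yes _ = f j
    ... | no  _ = 0

leftDegAt : {n : ℕ} → Multigraph n → VertexOrder n → Fin n → ℕ
leftDegAt G σ i = sumBefore i (λ j → mult G (σ ⟨$⟩ʳ i) (σ ⟨$⟩ʳ j))

sqCost : {n : ℕ} → Multigraph n → VertexOrder n → ℕ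
sqCost G σ = sumFin (λ i → leftDegAt G σ i * leftDegAt G σ i)

Bounded : {n : ℕ} → Multigraph n → VertexOrder n → ℕ → Set
Bounded G σ k = ∀ i → leftDegAt G σ i ≤ k

IsDegeneracy : {n : ℕ} → Multigraph n → ℕ → Set
IsDegeneracy G k =
  (Σ (VertexOrder _) λ σ → Bounded G σ k) ×
  (∀ k′ → (Σ (VertexOrder _) λ σ → Bounded G σ k′) → k ≤ k′)

-- Degree of the vertex at position p in the graph remaining when the greedy
-- algorithm (filling positions right to left) is about to fill position i,
-- i.e. the subgraph induced by the vertices at positions ≤ i.
remDeg : {n : ℕ} → Multigraph n → VertexOrder n → Fin n → Fin n → ℕ
remDeg G σ i p = sumUpTo i (λ j → mult G (σ ⟨$⟩ʳ p) (σ ⟨$⟩ʳ j))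

IsGreedy : {n : ℕ} → Multigraph n → VertexOrder n → Set
IsGreedy G σ = ∀ i p → p ≤ᶠ i → remDeg G σ i i ≤ remDeg G σ i p

{-# OPTIONS --safe #-}

-- Let ρ be a k-bounded order. When the greedy algorithm fills position i, the vertex of the
-- remaining graph that comes last in ρ has all its remaining neighbours before it in ρ, so
-- its remaining degree is at most k; the greedy vertex has minimum remaining degree, hence
-- left-degree at most k. Therefore Σ d_σ² ≤ k Σ d_σ = k |E|, and |E| = Σ d_τ ≤ Σ d_τ² for
-- every order τ, since the left-degrees of any order count each edge exactly once.
module Submission where

open import Defs
open import Data.Fin as F using (Fin; zero; suc) renaming (_<_ to _<ᶠ_; _≤_ to _≤ᶠ_)
import Data.Fin.Properties as FP
open import Data.Fin.Permutation using (Permutation′; _⟨$⟩ʳ_; _⟨$⟩ˡ_; inverseʳ; inverseˡ)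
open import Data.List using (List; filter; allFin)
import Data.List.Extrema
open import Data.List.Membership.Propositional.Properties using (∈-filter⁺; ∈-allFin)
open import Data.List.Relation.Unary.All using (lookup)
open import Data.List.Relation.Unary.All.Properties using (all-filter)
open import Data.Nat using (ℕ; zero; suc; _+_; _*_; _≤_; z≤n)
open import Data.Nat.Properties
open import Algebra.Properties.Semiring.Sum +-*-semiring
  using (sum; sum-permute; ∑-distrib-+; *-distribˡ-sum; ∑-comm)
open import Data.Product using (∃; _×_; _,_)
open import Data.Sum using (_⊎_; inj₁; inj₂)
open import Function using (_∘_; flip)
open import Relation.Binary.PropositionalEquality
open import Relation.Nullary using (Dec; yes; no; contradiction)
open import Relation.Unary using (Pred; Decidable)

sumFin≡sum : ∀ {n} (f : Fin n → ℕ) → sumFin f ≡ sum f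
sumFin≡sum {zero}  f = refl
sumFin≡sum {suc n} f = cong (f zero +_) (sumFin≡sum (f ∘ suc))

sumFin-cong : ∀ {n} {f g : Fin n → ℕ} → (∀ i → f i ≡ g i) → sumFin f ≡ sumFin g
sumFin-cong {zero}  f≗g = refl
sumFin-cong {suc n} f≗g = cong₂ _+_ (f≗g zero) (sumFin-cong (f≗g ∘ suc))

sumFin-mono-≤ : ∀ {n} {f g : Fin n → ℕ} → (∀ i → f i ≤ g i) → sumFin f ≤ sumFin g
sumFin-mono-≤ {zero}  f≤g = z≤n
sumFin-mono-≤ {suc n} f≤g = +-mono-≤ (f≤g zero) (sumFin-mono-≤ (f≤g ∘ suc))

sumFin-permute : ∀ {n} (f : Fin n → ℕ) (π : Permutation′ n) →
                 sumFin f ≡ sumFin (f ∘ (π ⟨$⟩ʳ_))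
sumFin-permute f π = begin
  sumFin f                 ≡⟨ sumFin≡sum f ⟩
  sum f                    ≡⟨ sum-permute f π ⟩
  sum (f ∘ (π ⟨$⟩ʳ_))      ≡⟨ sumFin≡sum (f ∘ (π ⟨$⟩ʳ_)) ⟨
  sumFin (f ∘ (π ⟨$⟩ʳ_))   ∎
  where open ≡-Reasoning

sumFin-distrib-+ : ∀ {n} (f g : Fin n → ℕ) → sumFin (λ i → f i + g i) ≡ sumFin f + sumFin g
sumFin-distrib-+ f g = begin
  sumFin (λ i → f i + g i)   ≡⟨ sumFin≡sum (λ i → f i + g i) ⟩
  sum (λ i → f i + g i)      ≡⟨ ∑-distrib-+ f g ⟩
  sum f + sum g              ≡⟨ cong₂ _+_ (sumFin≡sum f) (sumFin≡sum g) ⟨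
  sumFin f + sumFin g        ∎
  where open ≡-Reasoning

*-distribˡ-sumFin : ∀ {n} k (f : Fin n → ℕ) → k * sumFin f ≡ sumFin (λ i → k * f i)
*-distribˡ-sumFin k f = begin
  k * sumFin f               ≡⟨ cong (k *_) (sumFin≡sum f) ⟩
  k * sum f                  ≡⟨ *-distribˡ-sum k f ⟩
  sum (λ i → k * f i)        ≡⟨ sumFin≡sum (λ i → k * f i) ⟨
  sumFin (λ i → k * f i)     ∎
  where open ≡-Reasoning

sumFin-comm : ∀ {m n} (A : Fin m → Fin n → ℕ) →
              sumFin (λ i → sumFin (A i)) ≡ sumFin (λ j → sumFin (λ i → A i j))
sumFin-comm A = begin
  sumFin (λ i → sumFin (A i))            ≡⟨ sumFin²≡sum² A ⟩
  sum (λ i → sum (A i))                  ≡⟨ ∑-comm A ⟩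
  sum (λ j → sum (λ i → A i j))          ≡⟨ sumFin²≡sum² (flip A) ⟨
  sumFin (λ j → sumFin (λ i → A i j))    ∎
  where
  open ≡-Reasoning
  sumFin²≡sum² : ∀ {m n} (B : Fin m → Fin n → ℕ) →
                 sumFin (λ i → sumFin (B i)) ≡ sum (λ i → sum (B i))
  sumFin²≡sum² B = trans (sumFin-cong (sumFin≡sum ∘ B)) (sumFin≡sum (λ i → sum (B i)))

infix 8 _when_

_when_ : ∀ {p} {P : Set p} → ℕ → Dec P → ℕ
x when yes _ = x
x when no  _ = 0

when-mono-≤ : ∀ {p q} {P : Set p} {Q : Set q} x (P? : Dec P) (Q? : Dec Q) →
              (P → Q ⊎ x ≡ 0) → x when P? ≤ x when Q?
when-mono-≤ x (no _)  Q?      P⇒Q = z≤n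
when-mono-≤ x (yes _) (yes _) P⇒Q = ≤-refl
when-mono-≤ x (yes p) (no ¬q) P⇒Q with P⇒Q p
... | inj₁ q   = contradiction q ¬q
... | inj₂ x≡0 = ≤-reflexive x≡0

when-<-split : ∀ {n} (i j : Fin n) x → (i ≡ j → x ≡ 0) →
               x when (j F.<? i) + x when (i F.<? j) ≡ x
when-<-split i j x diagonal with j F.<? i | i F.<? j
... | yes j<i | yes i<j = contradiction i<j (FP.<-asym j<i)
... | yes _   | no  _   = +-identityʳ x
... | no  _   | yes _   = refl
... | no  j≮i | no  i≮j = sym (diagonal (FP.≤-antisym (≮⇒≥ j≮i) (≮⇒≥ i≮j)))

sumFin-when-permute : ∀ {p n} (π : Permutation′ n) (g : Fin n → ℕ)
                      {P : Pred (Fin n) p} (P? : Decidable P) →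
                      sumFin (λ j → g (π ⟨$⟩ʳ j) when P? j) ≡
                      sumFin (λ u → g u when P? (π ⟨$⟩ˡ u))
sumFin-when-permute π g P? = sym (trans
  (sumFin-permute (λ u → g u when P? (π ⟨$⟩ˡ u)) π)
  (sumFin-cong (λ j → cong (λ k → g (π ⟨$⟩ʳ j) when P? k) (inverseˡ π))))

-- Each left-hand side is the summand of sumBefore (sumUpTo), a with-function local to its
-- definition that cannot be named; forward declaration lets Agda infer it from the use below.
sumBefore-summand : ∀ {n} (i : Fin n) (f : Fin n → ℕ) j → _ ≡ f j when (j F.<? i)
sumUpTo-summand   : ∀ {n} (i : Fin n) (f : Fin n → ℕ) j → _ ≡ f j when (j F.≤? i)

sumBefore-when : ∀ {n} (i : Fin n) (f : Fin n → ℕ) →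
                 sumBefore i f ≡ sumFin (λ j → f j when (j F.<? i))
sumBefore-when i f = sumFin-cong (sumBefore-summand i f)

sumUpTo-when : ∀ {n} (i : Fin n) (f : Fin n → ℕ) →
               sumUpTo i f ≡ sumFin (λ j → f j when (j F.≤? i))
sumUpTo-when i f = sumFin-cong (sumUpTo-summand i f)

sumBefore-summand i f j with j F.<? i
... | yes _ = refl
... | no  _ = refl

sumUpTo-summand i f j with j F.≤? i
... | yes _ = refl
... | no  _ = refl

sumBefore≤sumUpTo : ∀ {n} (i : Fin n) (f : Fin n → ℕ) → sumBefore i f ≤ sumUpTo i f
sumBefore≤sumUpTo i f = begin
  sumBefore i f                        ≡⟨ sumBefore-when i f ⟩
  sumFin (λ j → f j when (j F.<? i))   ≤⟨ sumFin-mono-≤ strictBeforeIsBefore ⟩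
  sumFin (λ j → f j when (j F.≤? i))   ≡⟨ sumUpTo-when i f ⟨
  sumUpTo i f                          ∎
  where
  open ≤-Reasoning
  strictBeforeIsBefore : ∀ j → f j when (j F.<? i) ≤ f j when (j F.≤? i)
  strictBeforeIsBefore j = when-mono-≤ (f j) (j F.<? i) (j F.≤? i) (inj₁ ∘ <⇒≤)

sumBelowDiagonal : ∀ {n} → (Fin n → Fin n → ℕ) → ℕ
sumBelowDiagonal M = sumFin (λ i → sumFin (λ j → M i j when (j F.<? i)))

sumBelowDiagonal-double : ∀ {n} (M : Fin n → Fin n → ℕ) →
                          (∀ i j → M i j ≡ M j i) → (∀ i → M i i ≡ 0) →
                          2 * sumBelowDiagonal M ≡ sumFin (λ i → sumFin (M i))
sumBelowDiagonal-double {n} M symmetric zeroDiagonal = begin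
  2 * sumBelowDiagonal M
    ≡⟨ cong (sumBelowDiagonal M +_) (+-identityʳ (sumBelowDiagonal M)) ⟩
  sumBelowDiagonal M + sumBelowDiagonal M
    ≡⟨ cong (sumBelowDiagonal M +_) sumBelow≡sumAbove ⟩
  sumFin (λ i → sumFin (below i)) + sumFin (λ i → sumFin (above i))
    ≡⟨ sumFin-distrib-+ (λ i → sumFin (below i)) (λ i → sumFin (above i)) ⟨
  sumFin (λ i → sumFin (below i) + sumFin (above i))
    ≡⟨ sumFin-cong (λ i → sumFin-distrib-+ (below i) (above i)) ⟨
  sumFin (λ i → sumFin (λ j → below i j + above i j))
    ≡⟨ sumFin-cong (λ i → sumFin-cong (λ j → when-<-split i j (M i j) (diagonal≡0 i j))) ⟩
  sumFin (λ i → sumFin (M i))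
    ∎
  where
  open ≡-Reasoning
  below above : Fin n → Fin n → ℕ
  below i j = M i j when (j F.<? i)
  above i j = M i j when (i F.<? j)
  diagonal≡0 : ∀ i j → i ≡ j → M i j ≡ 0
  diagonal≡0 i .i refl = zeroDiagonal i
  sumBelow≡sumAbove : sumBelowDiagonal M ≡ sumFin (λ i → sumFin (above i))
  sumBelow≡sumAbove = trans
    (sumFin-cong (λ i → sumFin-cong (λ j → cong (_when (j F.<? i)) (symmetric i j))))
    (sumFin-comm (flip above))

leftDegSum : ∀ {n} → Multigraph n → VertexOrder n → ℕ
leftDegSum G σ = sumFin (leftDegAt G σ)

degreeSum : ∀ {n} → Multigraph n → ℕ
degreeSum G = sumFin (λ u → sumFin (mult G u))

leftDegSum-double : ∀ {n} (G : Multigraph n) (σ : VertexOrder n) →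
                    2 * leftDegSum G σ ≡ degreeSum G
leftDegSum-double {n} G σ = begin
  2 * leftDegSum G σ
    ≡⟨ cong (2 *_) (sumFin-cong (λ i → sumBefore-when i (M i))) ⟩
  2 * sumBelowDiagonal M
    ≡⟨ sumBelowDiagonal-double M (λ i j → symm G _ _) (λ i → loopFree G _) ⟩
  sumFin (λ i → sumFin (M i))
    ≡⟨ sumFin-cong (λ i → sumFin-permute (mult G (σ ⟨$⟩ʳ i)) σ) ⟨
  sumFin (λ i → sumFin (mult G (σ ⟨$⟩ʳ i)))
    ≡⟨ sumFin-permute (λ u → sumFin (mult G u)) σ ⟨
  degreeSum G
    ∎
  where
  open ≡-Reasoning
  M : Fin n → Fin n → ℕ
  M i j = mult G (σ ⟨$⟩ʳ i) (σ ⟨$⟩ʳ j)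

leftDegSum-invariant : ∀ {n} (G : Multigraph n) (σ τ : VertexOrder n) →
                       leftDegSum G σ ≡ leftDegSum G τ
leftDegSum-invariant G σ τ =
  *-cancelˡ-≡ _ _ 2 (trans (leftDegSum-double G σ) (sym (leftDegSum-double G τ)))

∃-argmax-≤ : ∀ {m n} (f : Fin n → Fin m) (i : Fin n) →
             ∃ λ p → p ≤ᶠ i × (∀ j → j ≤ᶠ i → f j ≤ᶠ f p)
∃-argmax-≤ {m} {n} f i =
  p ,
  argmax-all f FP.≤-refl (all-filter (F._≤? i) (allFin n)) ,
  λ j j≤i → lookup (f[xs]≤f[argmax] i ≤i) (∈-filter⁺ (F._≤? i) (∈-allFin j) j≤i)
  where
  open Data.List.Extrema (FP.≤-totalOrder m)
  ≤i : List (Fin n)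
  ≤i = filter (F._≤? i) (allFin n)
  p : Fin n
  p = argmax f i ≤i

remDeg≤leftDegAt-ofLast : ∀ {n} (G : Multigraph n) (σ ρ : VertexOrder n) (i p : Fin n) →
  (∀ j → j ≤ᶠ i → ρ ⟨$⟩ˡ (σ ⟨$⟩ʳ j) ≤ᶠ ρ ⟨$⟩ˡ (σ ⟨$⟩ʳ p)) →
  remDeg G σ i p ≤ leftDegAt G ρ (ρ ⟨$⟩ˡ (σ ⟨$⟩ʳ p))
remDeg≤leftDegAt-ofLast {n} G σ ρ i p last = begin
  remDeg G σ i p
    ≡⟨ sumUpTo-when i (mult G v ∘ (σ ⟨$⟩ʳ_)) ⟩
  sumFin (λ j → mult G v (σ ⟨$⟩ʳ j) when (j F.≤? i))
    ≡⟨ sumFin-when-permute σ (mult G v) (F._≤? i) ⟩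
  sumFin (λ u → mult G v u when (σ ⟨$⟩ˡ u F.≤? i))
    ≤⟨ sumFin-mono-≤ (λ u → when-mono-≤ (mult G v u) _ _ (beforeOrAt u)) ⟩
  sumFin (λ u → mult G v u when (ρ ⟨$⟩ˡ u F.<? q))
    ≡⟨ sumFin-when-permute ρ (mult G v) (F._<? q) ⟨
  sumFin (λ r → mult G v (ρ ⟨$⟩ʳ r) when (r F.<? q))
    ≡⟨ cong (λ w → sumFin (λ r → mult G w (ρ ⟨$⟩ʳ r) when (r F.<? q))) (inverseʳ ρ) ⟨
  sumFin (λ r → mult G (ρ ⟨$⟩ʳ q) (ρ ⟨$⟩ʳ r) when (r F.<? q))
    ≡⟨ sumBefore-when q (mult G (ρ ⟨$⟩ʳ q) ∘ (ρ ⟨$⟩ʳ_)) ⟨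
  leftDegAt G ρ q
    ∎
  where
  open ≤-Reasoning
  v q : Fin n
  v = σ ⟨$⟩ʳ p
  q = ρ ⟨$⟩ˡ v
  beforeOrAt : ∀ u → σ ⟨$⟩ˡ u ≤ᶠ i → ρ ⟨$⟩ˡ u <ᶠ q ⊎ mult G v u ≡ 0
  beforeOrAt u σu≤i with ρ ⟨$⟩ˡ u F.≟ q
  ... | no  ρu≢q = inj₁ (FP.≤∧≢⇒< ρu≤q ρu≢q)
    where
    ρu≤q : ρ ⟨$⟩ˡ u ≤ᶠ q
    ρu≤q = subst (λ w → ρ ⟨$⟩ˡ w ≤ᶠ q) (inverseʳ σ) (last (σ ⟨$⟩ˡ u) σu≤i)
  ... | yes ρu≡q = inj₂ (trans (cong (mult G v) u≡v) (loopFree G v))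
    where
    u≡v : u ≡ v
    u≡v = trans (sym (inverseʳ ρ)) (trans (cong (ρ ⟨$⟩ʳ_) ρu≡q) (inverseʳ ρ))

greedy-bounded : ∀ {n} (G : Multigraph n) (σ ρ : VertexOrder n) (k : ℕ) →
                 IsGreedy G σ → Bounded G ρ k → Bounded G σ k
greedy-bounded G σ ρ k greedy ρ-bounded i with ∃-argmax-≤ (λ j → ρ ⟨$⟩ˡ (σ ⟨$⟩ʳ j)) i
... | p , p≤i , last = begin
  leftDegAt G σ i                       ≤⟨ sumBefore≤sumUpTo i _ ⟩
  remDeg G σ i i                        ≤⟨ greedy i p p≤i ⟩
  remDeg G σ i p                        ≤⟨ remDeg≤leftDegAt-ofLast G σ ρ i p last ⟩
  leftDegAt G ρ (ρ ⟨$⟩ˡ (σ ⟨$⟩ʳ p))     ≤⟨ ρ-bounded (ρ ⟨$⟩ˡ (σ ⟨$⟩ʳ p)) ⟩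
  k                                     ∎
  where open ≤-Reasoning

sqCost≤bound*leftDegSum : ∀ {n} (G : Multigraph n) (σ : VertexOrder n) (k : ℕ) →
                          Bounded G σ k → sqCost G σ ≤ k * leftDegSum G σ
sqCost≤bound*leftDegSum G σ k bounded = begin
  sqCost G σ                            ≤⟨ sumFin-mono-≤ (λ i → *-monoˡ-≤ _ (bounded i)) ⟩
  sumFin (λ i → k * leftDegAt G σ i)    ≡⟨ *-distribˡ-sumFin k (leftDegAt G σ) ⟨
  k * leftDegSum G σ                    ∎
  where open ≤-Reasoning

leftDegSum≤sqCost : ∀ {n} (G : Multigraph n) (τ : VertexOrder n) → leftDegSum G τ ≤ sqCost G τ
leftDegSum≤sqCost G τ = sumFin-mono-≤ (λ i → n≤n*n (leftDegAt G τ i))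
  where
  n≤n*n : ∀ d → d ≤ d * d
  n≤n*n zero      = z≤n
  n≤n*n d@(suc _) = m≤m*n d d

theorem7 : ∀ {n : ℕ} (G : Multigraph n) (σ : VertexOrder n) (k : ℕ) →
           IsGreedy G σ → IsDegeneracy G k →
           ∀ (τ : VertexOrder n) → sqCost G σ ≤ k * sqCost G τ
theorem7 G σ k greedy ((ρ , ρ-bounded) , _) τ = begin
  sqCost G σ           ≤⟨ sqCost≤bound*leftDegSum G σ k σ-bounded ⟩
  k * leftDegSum G σ   ≡⟨ cong (k *_) (leftDegSum-invariant G σ τ) ⟩
  k * leftDegSum G τ   ≤⟨ *-monoʳ-≤ k (leftDegSum≤sqCost G τ) ⟩
  k * sqCost G τ       ∎
  where
  open ≤-Reasoning
  σ-bounded : Bounded G σ k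
  σ-bounded = greedy-bounded G σ ρ k greedy ρ-bounded
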